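{- Let $\mathcal C,\mathcal D$ be stable configuration structures. Then $\mathcal C$ and $\mathcal D$ are history-preserving (H) bisimilar if and only if $\mathcal C\equiv_{\mathrm{EIL}_h}\mathcal D$.
   Context: Configuration structures. A configuration structure over a label alphabet $\mathsf{Act}$ is a pair $\mathcal C=(C,\ell)$ where $C$ is a family of finite sets (configurations) and $\ell:\bigcup_{X\in C}X\to\mathsf{Act}$; $E_{\mathcal C}=\bigcup_{X\in C}X$. It is stable if: $\emptyset\in C$; every nonempty $X\in C$ has some $e\in X$ with $X\setminus\{e\}\in C$; whenever $X,Y,Z\in C$ with $X\cup Y\subseteq Z$, both $X\cup Y\in C$ and $X\cap Y\in C$. For $X\in C$: $d\le_X e$ iff for all $Y\in C$, $Y\subseteq X$, $e\in Y$ implies $d\in Y$; $d<_X e$ iff $d\le_X e$, $d\ne e$. $X\xrightarrow{e}X'$ iff $X,X'\in C$, $X\subseteq X'$, $X'\setminus X=\{e\}$; $X\xrightarrow{a}X'$ iff $X\xrightarrow{e}X'$ with $\ell(e)=a$. Standing assumption: image finiteness ($\{X':X\xrightarrow{a}X'\}$ finite for all $X,a$). $f:X\cong Y$ means $f$ is a label-preserving bijection with $d<_Xe\iff f(d)<_Yf(e)$. H bisimulation. $\mathcal R\subseteq C_{\mathcal C}\times C_{\mathcal D}\times\mathcal P(E_{\mathcal C}\times E_{\mathcal D})$ is an H bisimulation if $\mathcal R(\emptyset,\emptyset,\emptyset)$ and whenever $\mathcal R(X,Y,f)$, $a\in\mathsf{Act}$: $f:X\cong Y$; if $X\xrightarrow{a}X'$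 then there are $Y',f'$ with $Y\xrightarrow{a}Y'$, $\mathcal R(X',Y',f')$, $f'\restriction X=f$; symmetrically for $Y\xrightarrow{a}Y'$. EIL. Syntax $\phi::=\mathrm{tt}\mid\neg\phi\mid\phi\wedge\phi'\mid\langle x:a\rangle\phi\mid(x:a)\phi\mid\langle\!\langle x\rangle\!\rangle\phi$, where $\langle x:a\rangle$ and $(x:a)$ bind $x$; free identifiers $\mathrm{fi}$ defined as usual with $\mathrm{fi}(\langle\!\langle x\rangle\!\rangle\phi)=\mathrm{fi}(\phi)\cup\{x\}$; closed means no free identifiers. An environment $\rho$ (partial map identifiers $\to$ events) is permissible for $\phi$ and $X$ if $\mathrm{fi}(\phi)\subseteq\mathrm{dom}\rho$ and $\rho(\mathrm{fi}(\phi))\subseteq X$. Semantics: $\mathrm{tt}$ always holds, $\neg,\wedge$ classical; $X,\rho\models\langle x:a\rangle\phi$ iff $\exists X',e$: $X\xrightarrow{e}X'$, $\ell(e)=a$, $X',\rho[x\mapsto e]\models\phi$; $X,\rho\models(x:a)\phi$ iff $\exists e\in X$, $\ell(e)=a$, $X,\rho[x\mapsto e]\models\phi$; $X,\rho\models\langle\!\langle x\rangle\!\rangle\phi$ iff $\exists X',e$: $X'\xrightarrow{e}X$, $\rho(x)=e$, $\rho$ permissible for $\phi$ and $X'$, $X',\rho\models\phi$. For closed $\phi$, $\mathcal C\models\phi$ iff $\emptyset,\emptyset\models\phi$. $\mathcal C\equiv_L\mathcal D$ iff all closed $\phi\in L$ are satisfied by both or neither. Sublogics. $\mathrm{EIL}_{ro}$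 (reverse-only): $\phi::=\mathrm{tt}\mid\neg\phi\mid\phi\wedge\phi'\mid(x:a)\phi\mid\langle\!\langle x\rangle\!\rangle\phi$. $\mathrm{EIL}_h$: $\phi::=\mathrm{tt}\mid\neg\phi\mid\phi\wedge\phi'\mid\langle x:a\rangle\phi\mid(x:a)\phi\mid\phi_r$ where $\phi_r$ ranges over formulas of $\mathrm{EIL}_{ro}$ (so no forward modality occurs inside a reverse modality). -}

module Defs where

open import Level using (Level; 0ℓ) renaming (suc to lsuc)
open import Data.Nat using (ℕ)
open import Data.Nat.Properties using () renaming (_≟_ to _≟ℕ_)
open import Data.Maybe using (Maybe; just; nothing)
open import Data.List using (List; [])
open import Data.List.Membership.Propositional using (_∈_; _∉_)
open import Data.Product using (Σ; ∃; ∃-syntax; _×_; _,_)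
open import Data.Sum using (_⊎_)
open import Data.Unit using (⊤)
open import Data.Empty using (⊥)
open import Relation.Nullary using (¬_; yes; no)
open import Relation.Binary.PropositionalEquality using (_≡_; _≢_)
open import Function.Bundles using (_⇔_)

-- A configuration (a finite
-- set of events) is represented by a list of events (read as the set of
-- its elements); `Conf X` says that (the set of elements of) X is a
-- configuration.  All notions below only depend on lists through their
-- sets of elements (membership), so a list-predicate `Conf` faithfully
-- represents the family C of finite sets.  The labelling ℓ is total on
-- `Event`; only its restriction to E_C = ⋃ C is ever used.

record ConfStructure (Act : Set) : Set₁ where
  field
    Event : Set
    Conf  : List Event → Set
    ℓ     : Event → Act

module _ {Act : Set} (𝓒 : ConfStructure Act) where
  open ConfStructure 𝓒

  _⊆ₛ_ : List Event → List Event → Set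
  X ⊆ₛ Y = ∀ d → d ∈ X → d ∈ Y

  IsUnion : List Event → List Event → List Event → Set
  IsUnion U X Y = ∀ d → d ∈ U ⇔ (d ∈ X ⊎ d ∈ Y)

  IsInter : List Event → List Event → List Event → Set
  IsInter U X Y = ∀ d → d ∈ U ⇔ (d ∈ X × d ∈ Y)

  IsRemove : List Event → List Event → Event → Set
  IsRemove U X e = ∀ d → d ∈ U ⇔ (d ∈ X × d ≢ e)

  record Stable : Set where
    field
      empty-conf : Conf []
      rooted     : ∀ X → Conf X → (∃[ d ] d ∈ X) →
                   ∃[ e ] (e ∈ X × ∃[ U ] (Conf U × IsRemove U X e))
      union-conf : ∀ X Y Z → Conf X → Conf Y → Conf Z →
                   X ⊆ₛ Z → Y ⊆ₛ Z → ∃[ U ] (Conf U × IsUnion U X Y)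
      inter-conf : ∀ X Y Z → Conf X → Conf Y → Conf Z →
                   X ⊆ₛ Z → Y ⊆ₛ Z → ∃[ U ] (Conf U × IsInter U X Y)

  Step : List Event → Event → List Event → Set
  Step X e X' = Conf X × Conf X' × X ⊆ₛ X' × e ∈ X' × e ∉ X ×
                (∀ d → d ∈ X' → d ∈ X ⊎ d ≡ e)

  LStep : List Event → Act → List Event → Set
  LStep X a X' = ∃[ e ] (Step X e X' × ℓ e ≡ a)

  ImageFinite : Set
  ImageFinite = ∀ X a → ∃[ Ls ] (∀ X' → LStep X a X' →
                  ∃[ X'' ] (X'' ∈ Ls × (∀ d → d ∈ X' ⇔ d ∈ X'')))

  Leq : List Event → Event → Event → Set
  Leq X d e = ∀ Y → Conf Y → Y ⊆ₛ X → e ∈ Y → d ∈ Y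

  Lt : List Event → Event → Event → Set
  Lt X d e = Leq X d e × d ≢ e

module _ {Act : Set} (𝓒 𝓓 : ConfStructure Act) where
  private
    module C = ConfStructure 𝓒
    module D = ConfStructure 𝓓

  Rel : Set₁
  Rel = C.Event → D.Event → Set

  emptyRel : Rel
  emptyRel _ _ = ⊥

  RestrictsTo : Rel → List C.Event → Rel → Set
  RestrictsTo f' X f = ∀ d e → (f' d e × d ∈ X) ⇔ f d e

  record Iso (f : Rel) (X : List C.Event) (Y : List D.Event) : Set where
    field
      dom⊆     : ∀ d e → f d e → d ∈ X × e ∈ Y
      total    : ∀ d → d ∈ X → ∃[ e ] f d e
      surj     : ∀ e → e ∈ Y → ∃[ d ] f d e
      func     : ∀ d e e' → f d e → f d e' → e ≡ e'
      inj      : ∀ d d' e → f d e → f d' e → d ≡ d'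
      labels   : ∀ d e → f d e → C.ℓ d ≡ D.ℓ e
      order    : ∀ d e d' e' → f d e → f d' e' →
                 Lt 𝓒 X d d' ⇔ Lt 𝓓 Y e e'

  Triple : Set₂
  Triple = List C.Event → List D.Event → Rel → Set₁

  record IsHBisim (R : Triple) : Set₁ where
    field
      init  : R [] [] emptyRel
      confs : ∀ {X Y f} → R X Y f → C.Conf X × D.Conf Y
      iso   : ∀ {X Y f} → R X Y f → Iso f X Y
      forth : ∀ {X Y f} → R X Y f → ∀ a X' → LStep 𝓒 X a X' →
              ∃[ Y' ] Σ Rel λ f' → LStep 𝓓 Y a Y' × R X' Y' f' × RestrictsTo f' X f
      back  : ∀ {X Y f} → R X Y f → ∀ a Y' → LStep 𝓓 Y a Y' →
              ∃[ X' ] Σ Rel λ f' → LStep 𝓒 X a X' × R X' Y' f' × RestrictsTo f' X f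

  HBisimilar : Set₂
  HBisimilar = Σ Triple IsHBisim

Ident : Set
Ident = ℕ

data Form (Act : Set) : Set where
  tt      : Form Act
  ¬'_     : Form Act → Form Act
  _∧'_    : Form Act → Form Act → Form Act
  ⟨_∶_⟩_  : Ident → Act → Form Act → Form Act
  [_∶_]_  : Ident → Act → Form Act → Form Act
  ⟪_⟫_    : Ident → Form Act → Form Act

data FreeIn {Act : Set} (x : Ident) : Form Act → Set where
  fi-¬   : ∀ {φ} → FreeIn x φ → FreeIn x (¬' φ)
  fi-∧ˡ  : ∀ {φ ψ} → FreeIn x φ → FreeIn x (φ ∧' ψ)
  fi-∧ʳ  : ∀ {φ ψ} → FreeIn x ψ → FreeIn x (φ ∧' ψ)
  fi-fwd : ∀ {y a φ} → x ≢ y → FreeIn x φ → FreeIn x (⟨ y ∶ a ⟩ φ)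
  fi-dec : ∀ {y a φ} → x ≢ y → FreeIn x φ → FreeIn x ([ y ∶ a ] φ)
  fi-revˡ : ∀ {φ} → FreeIn x (⟪ x ⟫ φ)
  fi-revʳ : ∀ {y φ} → FreeIn x φ → FreeIn x (⟪ y ⟫ φ)

Closed : {Act : Set} → Form Act → Set
Closed φ = ∀ x → ¬ FreeIn x φ

data IsRO {Act : Set} : Form Act → Set where
  ro-tt  : IsRO tt
  ro-¬   : ∀ {φ} → IsRO φ → IsRO (¬' φ)
  ro-∧   : ∀ {φ ψ} → IsRO φ → IsRO ψ → IsRO (φ ∧' ψ)
  ro-dec : ∀ {x a φ} → IsRO φ → IsRO ([ x ∶ a ] φ)
  ro-rev : ∀ {x φ} → IsRO φ → IsRO (⟪ x ⟫ φ)

data IsH {Act : Set} : Form Act → Set where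
  h-tt  : IsH tt
  h-¬   : ∀ {φ} → IsH φ → IsH (¬' φ)
  h-∧   : ∀ {φ ψ} → IsH φ → IsH ψ → IsH (φ ∧' ψ)
  h-fwd : ∀ {x a φ} → IsH φ → IsH (⟨ x ∶ a ⟩ φ)
  h-dec : ∀ {x a φ} → IsH φ → IsH ([ x ∶ a ] φ)
  h-ro  : ∀ {φ} → IsRO φ → IsH φ

module _ {Act : Set} (𝓒 : ConfStructure Act) where
  open ConfStructure 𝓒

  Env : Set
  Env = Ident → Maybe Event

  emptyEnv : Env
  emptyEnv _ = nothing

  _[_↦_] : Env → Ident → Event → Env
  (ρ [ x ↦ e ]) y with y ≟ℕ x
  ... | yes _ = just e
  ... | no  _ = ρ y

  Permissible : Form Act → List Event → Env → Set
  Permissible φ X ρ = ∀ x → FreeIn x φ → ∃[ e ] (ρ x ≡ just e × e ∈ X)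

  Sat : List Event → Env → Form Act → Set
  Sat X ρ tt          = ⊤
  Sat X ρ (¬' φ)      = ¬ Sat X ρ φ
  Sat X ρ (φ ∧' ψ)    = Sat X ρ φ × Sat X ρ ψ
  Sat X ρ (⟨ x ∶ a ⟩ φ) = ∃[ X' ] ∃[ e ] (Step 𝓒 X e X' × ℓ e ≡ a × Sat X' (ρ [ x ↦ e ]) φ)
  Sat X ρ ([ x ∶ a ] φ) = ∃[ e ] (e ∈ X × ℓ e ≡ a × Sat X (ρ [ x ↦ e ]) φ)
  Sat X ρ (⟪ x ⟫ φ)     = ∃[ X' ] ∃[ e ] (Step 𝓒 X' e X × ρ x ≡ just e ×
                                         Permissible φ X' ρ × Sat X' ρ φ)

  Models : Form Act → Set
  Models φ = Sat [] emptyEnv φ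

EquivH : {Act : Set} → ConfStructure Act → ConfStructure Act → Set
EquivH {Act} 𝓒 𝓓 = ∀ (φ : Form Act) → IsH φ → Closed φ → (Models 𝓒 φ ⇔ Models 𝓓 φ)

module Submission where

-- In a triple (X , Y , f) of an H bisimulation, X and Y satisfy the same EIL_h
-- formulas under environments related by f (h-invariance): forward steps are transferred by
-- the bisimulation, declarations by the isomorphism f : X ≅ Y.  Inside a reverse-only formula
-- only f matters (ro-invariance): reversing e in X is matched by reversing f e in Y, because
-- f e is causally maximal, so Y ∖ {f e} is a configuration (remove-maximal, using stability)
-- onto which f restricts (iso-restrict).
--
-- Call (X , Y , f) matched if f : X ≅ Y and, for some naming of the events by
-- the identifiers below N, X and Y satisfy the same EIL_h formulas over these names.  Matched
-- triples form an H bisimulation.  Every X —e→ X' is matched by some Y —e'→ Y': otherwise, by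
-- image finiteness, finitely many formulas refute all candidates and ⟨N : a⟩ of their
-- conjunction tells X from Y.  The extension of f by (e , e') preserves causality because
-- d ≰ e is expressible in EIL_ro (leq-iff-unseparated): keep reversing events until d itself
-- can be reversed while e stays.

open import Defs
open import Level using (0ℓ; Lift; lift) renaming (suc to lsuc)
open import Axiom.ExcludedMiddle using (ExcludedMiddle)
open import Function.Base using (flip)
open import Function.Bundles using (_⇔_; mk⇔; module Equivalence)
import Function.Properties.Equivalence as ⇔
open import Function.Related.TypeIsomorphisms using (¬-cong-⇔)
open import Data.Product.Function.NonDependent.Propositional using (_×-⇔_)
open import Data.Nat using (ℕ; zero; suc; _≤_; _<_; z≤n; s≤s; _+_; _≤?_)
open import Data.Nat.Properties
  using (≤-trans; <-≤-trans; m≤m+n; m≤n+m; n≤1+n; ≤-pred; ≤∧≢⇒<; ≰⇒>; m<n⇒m<1+n; n<1+n; <⇒≢; <⇒≤; n≮0)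
  renaming (_≟_ to _≟ℕ_)
open import Data.Maybe using (Maybe; just; nothing)
open import Data.Maybe.Properties using (just-injective)
open import Data.List using (List; []; _∷_; map; length)
open import Data.List.Membership.Propositional using (_∈_; _∉_)
open import Data.List.Relation.Unary.Any using (here; there)
open import Data.List.Membership.Propositional.Properties using (∈-map⁺)
open import Data.Product using (∃; ∃-syntax; _×_; _,_; proj₁; proj₂)
open import Data.Sum using (_⊎_; inj₁; inj₂; [_,_]′; map₁; map₂)
open import Data.Empty using (⊥; ⊥-elim)
open import Relation.Nullary using (¬_; Dec; yes; no)
open import Relation.Binary.PropositionalEquality using (_≡_; _≢_; refl; sym; trans; subst)

open Equivalence using () renaming (to to ⇒; from to ⇐)

_⊆_ : {E : Set} → List E → List E → Set
U ⊆ V = ∀ d → d ∈ U → d ∈ V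

_↾_ : {E F : Set} → (E → F → Set) → List E → E → F → Set
(f ↾ X') d y = f d y × d ∈ X'

extend : {E F : Set} → (E → F → Set) → E → F → E → F → Set
extend f e e' d y = f d y ⊎ (d ≡ e × y ≡ e')

module _ {Act : Set} (𝓒 : ConfStructure Act) where
  open ConfStructure 𝓒

  update-here : ∀ (ρ : Env 𝓒) x e → _[_↦_] 𝓒 ρ x e x ≡ just e
  update-here ρ x e with x ≟ℕ x
  ... | yes _ = refl
  ... | no x≢x = ⊥-elim (x≢x refl)

  update-there : ∀ (ρ : Env 𝓒) x e {y} → y ≢ x → _[_↦_] 𝓒 ρ x e y ≡ ρ y
  update-there ρ x e {y} y≢x with y ≟ℕ x
  ... | yes y≡x = ⊥-elim (y≢x y≡x)
  ... | no _ = refl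

  module _ {X : List Event} {e : Event} {X' : List Event} (s : Step 𝓒 X e X') where
    step-source : Conf X
    step-source = proj₁ s

    step-target : Conf X'
    step-target = proj₁ (proj₂ s)

    step-⊆ : X ⊆ X'
    step-⊆ = proj₁ (proj₂ (proj₂ s))

    step-new∈ : e ∈ X'
    step-new∈ = proj₁ (proj₂ (proj₂ (proj₂ s)))

    step-new∉ : e ∉ X
    step-new∉ = proj₁ (proj₂ (proj₂ (proj₂ (proj₂ s))))

    step-old : ∀ d → d ∈ X' → d ∈ X ⊎ d ≡ e
    step-old = proj₂ (proj₂ (proj₂ (proj₂ (proj₂ s))))

  step-event-unique : ∀ {Y e₁ Y₁ e₂ Y₂} → Step 𝓒 Y e₁ Y₁ → Step 𝓒 Y e₂ Y₂ → Y₂ ⊆ Y₁ → e₂ ≡ e₁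
  step-event-unique s₁ s₂ Y₂⊆Y₁ with step-old s₁ _ (Y₂⊆Y₁ _ (step-new∈ s₂))
  ... | inj₁ e₂∈Y = ⊥-elim (step-new∉ s₂ e₂∈Y)
  ... | inj₂ e₂≡e₁ = e₂≡e₁

leq-shrink : ∀ {Act} (𝓒 : ConfStructure Act) {X X' d₁ d₂} → X ⊆ X' → Leq 𝓒 X' d₁ d₂ → Leq 𝓒 X d₁ d₂
leq-shrink 𝓒 X⊆X' le Z cZ Z⊆X = le Z cZ (λ d p → X⊆X' d (Z⊆X d p))

module _ {Act : Set} {𝓒 : ConfStructure Act} (st : Stable 𝓒) where
  open ConfStructure 𝓒
  open Stable st

  leq-restrict : ∀ {X X' d₁ d₂} → Conf X → Conf X' → X ⊆ X' → d₂ ∈ X →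
                 Leq 𝓒 X' d₁ d₂ ⇔ Leq 𝓒 X d₁ d₂
  leq-restrict {X} {X'} {d₁} {d₂} cX cX' X⊆X' d₂∈X = mk⇔ (leq-shrink 𝓒 X⊆X') grow
    where
    -- a configuration Z ⊆ X' containing d₂ is cut down to Z ∩ X
    grow : Leq 𝓒 X d₁ d₂ → Leq 𝓒 X' d₁ d₂
    grow le Z cZ Z⊆X' d₂∈Z with inter-conf Z X X' cZ cX cX' Z⊆X' X⊆X'
    ... | U , cU , U=Z∩X = proj₁ (⇒ (U=Z∩X d₁)
            (le U cU (λ d p → proj₂ (⇒ (U=Z∩X d) p)) (⇐ (U=Z∩X d₂) (d₂∈Z , d₂∈X))))

  lt-restrict : ∀ {X X' d₁ d₂} → Conf X → Conf X' → X ⊆ X' → d₂ ∈ X →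
                Lt 𝓒 X' d₁ d₂ ⇔ Lt 𝓒 X d₁ d₂
  lt-restrict cX cX' X⊆X' d₂∈X = leq-restrict cX cX' X⊆X' d₂∈X ×-⇔ ⇔.refl

  step-lt-restrict : ∀ {X e X' d₁ d₂} → Step 𝓒 X e X' → d₂ ∈ X → Lt 𝓒 X' d₁ d₂ ⇔ Lt 𝓒 X d₁ d₂
  step-lt-restrict s = lt-restrict (step-source 𝓒 s) (step-target 𝓒 s) (step-⊆ 𝓒 s)

new-not-below : ∀ {Act} (𝓒 : ConfStructure Act) {X e X' d} → Step 𝓒 X e X' → d ∈ X → ¬ Leq 𝓒 X' e d
new-not-below 𝓒 {X} s d∈X e≤d = step-new∉ 𝓒 s (e≤d X (step-source 𝓒 s) (step-⊆ 𝓒 s) d∈X)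

module _ {Act : Set} (𝓒 : ConfStructure Act) where
  open ConfStructure 𝓒

  module _ {U V : List Event} {y : Event} (r : IsRemove 𝓒 U V y) where
    remove-⊆ : U ⊆ V
    remove-⊆ d p = proj₁ (⇒ (r d) p)

    remove-∉ : y ∉ U
    remove-∉ p = proj₂ (⇒ (r y) p) refl

    remove-keeps : ∀ {d} → d ∈ V → d ≢ y → d ∈ U
    remove-keeps d∈V d≢y = ⇐ (r _) (d∈V , d≢y)

    remove-outside : ∀ {W} → W ⊆ V → y ∉ W → W ⊆ U
    remove-outside W⊆V y∉W d d∈W = remove-keeps (W⊆V d d∈W) λ { refl → y∉W d∈W }

RelEnv : ∀ {Act} (𝓒 𝓓 : ConfStructure Act) → Rel 𝓒 𝓓 → Form Act → Env 𝓒 → Env 𝓓 → Set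
RelEnv 𝓒 𝓓 f φ ρ σ = ∀ x → FreeIn x φ → ∃[ d ] ∃[ y ] (ρ x ≡ just d × σ x ≡ just y × f d y)

module _ {Act : Set} {𝓒 𝓓 : ConfStructure Act} where
  private
    module C = ConfStructure 𝓒
    module D = ConfStructure 𝓓

  iso-flip : ∀ {g : Rel 𝓓 𝓒} {X Y} → Iso 𝓓 𝓒 g Y X → Iso 𝓒 𝓓 (flip g) X Y
  iso-flip i = record
    { dom⊆ = λ d y p → proj₂ (Iso.dom⊆ i y d p) , proj₁ (Iso.dom⊆ i y d p)
    ; total = Iso.surj i
    ; surj = Iso.total i
    ; func = λ d y y' p q → Iso.inj i y y' d p q
    ; inj = λ d d' y p q → Iso.func i y d d' p q
    ; labels = λ d y p → sym (Iso.labels i y d p)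
    ; order = λ d y d' y' p q → ⇔.sym (Iso.order i y d y' d' p q) }

  -- An isomorphism X ≅ Y restricts to sub-configurations X' ⊆ X and Y' ⊆ Y that it maps
  -- onto each other; the order is preserved because causality is local (lt-restrict).
  iso-restrict : ∀ {f X Y X' Y'} → Stable 𝓒 → Stable 𝓓 → Iso 𝓒 𝓓 f X Y →
                 C.Conf X → D.Conf Y → C.Conf X' → D.Conf Y' → X' ⊆ X → Y' ⊆ Y →
                 (∀ d y → f d y → d ∈ X' ⇔ y ∈ Y') → Iso 𝓒 𝓓 (f ↾ X') X' Y'
  iso-restrict stC stD i cX cY cX' cY' X'⊆X Y'⊆Y matches = record
    { dom⊆ = λ d y (p , d∈X') → d∈X' , ⇒ (matches d y p) d∈X'
    ; total = λ d d∈X' → let (y , p) = Iso.total i d (X'⊆X d d∈X') in y , p , d∈X'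
    ; surj = λ y y∈Y' → let (d , p) = Iso.surj i y (Y'⊆Y y y∈Y') in d , p , ⇐ (matches d y p) y∈Y'
    ; func = λ d y y' p q → Iso.func i d y y' (proj₁ p) (proj₁ q)
    ; inj = λ d d' y p q → Iso.inj i d d' y (proj₁ p) (proj₁ q)
    ; labels = λ d y p → Iso.labels i d y (proj₁ p)
    ; order = λ d y d' y' (p , _) (q , d'∈X') →
        ⇔.trans (⇔.sym (lt-restrict stC cX' cX X'⊆X d'∈X'))
          (⇔.trans (Iso.order i d y d' y' p q)
            (lt-restrict stD cY' cY Y'⊆Y (⇒ (matches d' y' q) d'∈X'))) }

  -- The causal orders are matched by extend f e e' as soon as they are for pairs of an old
  -- and the new event: pairs of old events by lt-restrict, and the new event is below no old one.
  extend-order : ∀ {f X Y e e' X' Y'} → Stable 𝓒 → Stable 𝓓 → Iso 𝓒 𝓓 f X Y →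
                 Step 𝓒 X e X' → Step 𝓓 Y e' Y' → (∀ d y → f d y → Lt 𝓒 X' d e ⇔ Lt 𝓓 Y' y e') →
                 ∀ d y d' y' → extend f e e' d y → extend f e e' d' y' → Lt 𝓒 X' d d' ⇔ Lt 𝓓 Y' y y'
  extend-order stC stD i sX sY below-new d y d' y' (inj₁ p) (inj₁ q) =
    ⇔.trans (step-lt-restrict stC sX (proj₁ (Iso.dom⊆ i d' y' q)))
      (⇔.trans (Iso.order i d y d' y' p q) (⇔.sym (step-lt-restrict stD sY (proj₂ (Iso.dom⊆ i d' y' q)))))
  extend-order stC stD i sX sY below-new d y d' y' (inj₁ p) (inj₂ (refl , refl)) = below-new d y p
  extend-order stC stD i sX sY below-new d y d' y' (inj₂ (refl , refl)) (inj₁ q) = mk⇔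
    (λ (e≤d' , _) → ⊥-elim (new-not-below 𝓒 sX (proj₁ (Iso.dom⊆ i d' y' q)) e≤d'))
    (λ (e'≤y' , _) → ⊥-elim (new-not-below 𝓓 sY (proj₂ (Iso.dom⊆ i d' y' q)) e'≤y'))
  extend-order stC stD i sX sY below-new d y d' y' (inj₂ (refl , refl)) (inj₂ (refl , refl)) =
    mk⇔ (λ (_ , e≢e) → ⊥-elim (e≢e refl)) (λ (_ , e'≢e') → ⊥-elim (e'≢e' refl))

  iso-extend : ∀ {f X Y e e' X' Y'} → Stable 𝓒 → Stable 𝓓 → Iso 𝓒 𝓓 f X Y →
               (sX : Step 𝓒 X e X') (sY : Step 𝓓 Y e' Y') → C.ℓ e ≡ D.ℓ e' →
               (∀ d y → f d y → Lt 𝓒 X' d e ⇔ Lt 𝓓 Y' y e') →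
               Iso 𝓒 𝓓 (extend f e e') X' Y'
  iso-extend {f} {X} {Y} {e} {e'} {X'} {Y'} stC stD i sX sY ℓe≡ℓe' below-new = record
    { dom⊆ = dom⊆ ; total = total ; surj = surj ; func = func ; inj = inj
    ; labels = labels ; order = extend-order stC stD i sX sY below-new }
    where
    F : Rel 𝓒 𝓓
    F = extend f e e'
    dom⊆ : ∀ d y → F d y → d ∈ X' × y ∈ Y'
    dom⊆ d y (inj₁ p) = step-⊆ 𝓒 sX d (proj₁ (Iso.dom⊆ i d y p)) , step-⊆ 𝓓 sY y (proj₂ (Iso.dom⊆ i d y p))
    dom⊆ d y (inj₂ (refl , refl)) = step-new∈ 𝓒 sX , step-new∈ 𝓓 sY
    total : ∀ d → d ∈ X' → ∃[ y ] F d y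
    total d d∈X' with step-old 𝓒 sX d d∈X'
    ... | inj₁ d∈X = let (y , p) = Iso.total i d d∈X in y , inj₁ p
    ... | inj₂ refl = e' , inj₂ (refl , refl)
    surj : ∀ y → y ∈ Y' → ∃[ d ] F d y
    surj y y∈Y' with step-old 𝓓 sY y y∈Y'
    ... | inj₁ y∈Y = let (d , p) = Iso.surj i y y∈Y in d , inj₁ p
    ... | inj₂ refl = e , inj₂ (refl , refl)
    func : ∀ d y y' → F d y → F d y' → y ≡ y'
    func d y y' (inj₁ p) (inj₁ q) = Iso.func i d y y' p q
    func d y y' (inj₁ p) (inj₂ (refl , _)) = ⊥-elim (step-new∉ 𝓒 sX (proj₁ (Iso.dom⊆ i d y p)))
    func d y y' (inj₂ (refl , _)) (inj₁ q) = ⊥-elim (step-new∉ 𝓒 sX (proj₁ (Iso.dom⊆ i d y' q)))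
    func d y y' (inj₂ (_ , refl)) (inj₂ (_ , refl)) = refl
    inj : ∀ d d' y → F d y → F d' y → d ≡ d'
    inj d d' y (inj₁ p) (inj₁ q) = Iso.inj i d d' y p q
    inj d d' y (inj₁ p) (inj₂ (_ , refl)) = ⊥-elim (step-new∉ 𝓓 sY (proj₂ (Iso.dom⊆ i d y p)))
    inj d d' y (inj₂ (_ , refl)) (inj₁ q) = ⊥-elim (step-new∉ 𝓓 sY (proj₂ (Iso.dom⊆ i d' y q)))
    inj d d' y (inj₂ (refl , _)) (inj₂ (refl , _)) = refl
    labels : ∀ d y → F d y → C.ℓ d ≡ D.ℓ y
    labels d y (inj₁ p) = Iso.labels i d y p
    labels d y (inj₂ (refl , refl)) = ℓe≡ℓe'

  labels-covered : ∀ {f X Y e e' X' Y'} → Iso 𝓒 𝓓 f X Y → Step 𝓒 X e X' → Step 𝓓 Y e' Y' →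
                   C.ℓ e ≡ D.ℓ e' → ∀ g → g ∈ Y' → D.ℓ g ∈ map C.ℓ X'
  labels-covered {X' = X'} i sX sY ℓe≡ℓe' g g∈Y' with step-old 𝓓 sY g g∈Y'
  ... | inj₂ refl = subst (_∈ map C.ℓ X') ℓe≡ℓe' (∈-map⁺ C.ℓ (step-new∈ 𝓒 sX))
  ... | inj₁ g∈Y = let (c , fcg) = Iso.surj i g g∈Y in
        subst (_∈ map C.ℓ X') (Iso.labels i c g fcg) (∈-map⁺ C.ℓ (step-⊆ 𝓒 sX c (proj₁ (Iso.dom⊆ i c g fcg))))

  restricts-codomain : ∀ {f f' X X' Y Y'} → Iso 𝓒 𝓓 f' X' Y' → Iso 𝓒 𝓓 f X Y →
                       RestrictsTo 𝓒 𝓓 f' X f → ∀ d y → (f' d y × y ∈ Y) ⇔ f d y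
  restricts-codomain {f} {f'} {Y = Y} i' i res d y =
    mk⇔ to (λ p → proj₁ (⇐ (res d y) p) , proj₂ (Iso.dom⊆ i d y p))
    where
    to : f' d y × y ∈ Y → f d y
    to (p , y∈Y) with Iso.surj i y y∈Y
    ... | d₀ , q with Iso.inj i' d d₀ y p (proj₁ (⇐ (res d₀ y) q))
    ... | refl = q

  restricts-after-step : ∀ {F f X Y e X'} → Step 𝓒 X e X' → Iso 𝓒 𝓓 f X Y →
                         (∀ d y → F d y → f d y ⊎ d ≡ e) → (∀ d y → f d y → F d y) →
                         RestrictsTo 𝓒 𝓓 F X f
  restricts-after-step {F} {f} {X} s i old-or-new f⊆F d y = mk⇔ to (λ p → f⊆F d y p , proj₁ (Iso.dom⊆ i d y p))
    where
    to : F d y × d ∈ X → f d y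
    to (p , d∈X) with old-or-new d y p
    ... | inj₁ q = q
    ... | inj₂ refl = ⊥-elim (step-new∉ 𝓒 s d∈X)

  rel-env-flip : ∀ {g : Rel 𝓓 𝓒} {φ ρ σ} → RelEnv 𝓓 𝓒 g φ σ ρ → RelEnv 𝓒 𝓓 (flip g) φ ρ σ
  rel-env-flip r x q = let (y , d , σx , ρx , p) = r x q in d , y , ρx , σx , p

  rel-env-update : ∀ {f φ ψ ρ σ} x e y → f e y → (∀ z → FreeIn z φ → z ≢ x → FreeIn z ψ) →
                   RelEnv 𝓒 𝓓 f ψ ρ σ → RelEnv 𝓒 𝓓 f φ (_[_↦_] 𝓒 ρ x e) (_[_↦_] 𝓓 σ x y)
  rel-env-update {ρ = ρ} {σ} x e y p bound r z q with z ≟ℕ x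
  ... | yes refl = e , y , refl , refl , p
  ... | no z≢x = r z (bound z q z≢x)

module Classical (em : ExcludedMiddle (lsuc 0ℓ)) where

  dec : (P : Set) → Dec P
  dec P with em {Lift (lsuc 0ℓ) P}
  ... | yes (lift p) = yes p
  ... | no ¬p = no (λ p → ¬p (lift p))

  dne : {P : Set} → ¬ ¬ P → P
  dne {P} ¬¬p with dec P
  ... | yes p = p
  ... | no ¬p = ⊥-elim (¬¬p ¬p)

  module _ {Act : Set} (𝓒 : ConfStructure Act) where
    open ConfStructure 𝓒

    avoiding-witness : ∀ {V d e} → ¬ Leq 𝓒 V d e → ∃[ W ] (Conf W × W ⊆ V × e ∈ W × d ∉ W)
    avoiding-witness {V} {d} {e} d≰e with dec (∃[ W ] (Conf W × W ⊆ V × e ∈ W × d ∉ W))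
    ... | yes witness = witness
    ... | no none = ⊥-elim (d≰e λ W cW W⊆V e∈W → dne (λ d∉W → none (W , cW , W⊆V , e∈W , d∉W)))

    removal-step : ∀ {U V y} → Conf U → Conf V → IsRemove 𝓒 U V y → y ∈ V → Step 𝓒 U y V
    removal-step {U} {V} {y} cU cV r y∈V =
      cU , cV , remove-⊆ 𝓒 r , y∈V , remove-∉ 𝓒 r , λ d d∈V → kept-or-removed d d∈V (dec (d ≡ y))
      where
      kept-or-removed : ∀ d → d ∈ V → Dec (d ≡ y) → d ∈ U ⊎ d ≡ y
      kept-or-removed d d∈V (yes d≡y) = inj₂ d≡y
      kept-or-removed d d∈V (no d≢y) = inj₁ (remove-keeps 𝓒 r d∈V d≢y)

    module _ (st : Stable 𝓒) where
      open Stable st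

      -- Removing a ≤_Y-maximal event e from a configuration Y yields a configuration: each
      -- other g ∈ Y lies in a configuration inside Y avoiding e, and their union is Y ∖ {e}.
      remove-maximal : ∀ {Y e} → Conf Y → (∀ g → g ∈ Y → g ≢ e → ¬ Leq 𝓒 Y e g) →
                       ∃[ U ] (Conf U × IsRemove 𝓒 U Y e)
      remove-maximal {Y} {e} cY maximal with cover Y (λ _ p → p)
        where
        cover : ∀ L → L ⊆ Y → ∃[ U ] (Conf U × U ⊆ Y × e ∉ U × (∀ g → g ∈ L → g ≢ e → g ∈ U))
        cover [] _ = [] , empty-conf , (λ _ ()) , (λ ()) , (λ _ ())
        cover (g ∷ L) gL⊆Y with cover L (λ d p → gL⊆Y d (there p)) | dec (g ≡ e)
        ... | U , cU , U⊆Y , e∉U , covers | yes refl =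
              U , cU , U⊆Y , e∉U , λ { _ (here refl) g≢g → ⊥-elim (g≢g refl) ; g' (there p) → covers g' p }
        ... | U , cU , U⊆Y , e∉U , covers | no g≢e
              with avoiding-witness (maximal g (gL⊆Y g (here refl)) g≢e)
        ...   | W , cW , W⊆Y , g∈W , e∉W with union-conf U W Y cU cW cY U⊆Y W⊆Y
        ...     | V , cV , V=U∪W = V , cV , V⊆Y , e∉V , covers'
          where
          V⊆Y : V ⊆ Y
          V⊆Y d p = [ U⊆Y d , W⊆Y d ]′ (⇒ (V=U∪W d) p)
          e∉V : e ∉ V
          e∉V p = [ e∉U , e∉W ]′ (⇒ (V=U∪W e) p)
          covers' : ∀ g' → g' ∈ g ∷ L → g' ≢ e → g' ∈ V
          covers' _ (here refl) _ = ⇐ (V=U∪W g) (inj₂ g∈W)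
          covers' g' (there p) g'≢e = ⇐ (V=U∪W g') (inj₁ (covers g' p g'≢e))
      ... | U , cU , U⊆Y , e∉U , covers =
            U , cU , λ d → mk⇔ (λ p → U⊆Y d p , λ d≡e → e∉U (subst (_∈ U) d≡e p))
                              (λ (d∈Y , d≢e) → covers d d∈Y d≢e)

  module _ {Act : Set} {𝓒 𝓓 : ConfStructure Act} where
    private
      module C = ConfStructure 𝓒
      module D = ConfStructure 𝓓

    image-maximal : ∀ {f X Y X' e y} → Iso 𝓒 𝓓 f X Y → Step 𝓒 X' e X → f e y →
                    ∀ g → g ∈ Y → g ≢ y → ¬ Leq 𝓓 Y y g
    image-maximal i s fey g g∈Y g≢y y≤g with Iso.surj i g g∈Y
    ... | c , fcg with step-old 𝓒 s c (proj₁ (Iso.dom⊆ i c g fcg))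
    ... | inj₁ c∈X' = new-not-below 𝓒 s c∈X' (proj₁ (⇐ (Iso.order i _ _ c g fey fcg) (y≤g , λ y≡g → g≢y (sym y≡g))))
    ... | inj₂ refl = g≢y (Iso.func i _ g _ fcg fey)

    iso-reverse : ∀ {f X Y X' e y} → Stable 𝓒 → Stable 𝓓 → D.Conf Y → Iso 𝓒 𝓓 f X Y →
                  Step 𝓒 X' e X → f e y → ∃[ Y' ] (Step 𝓓 Y' y Y × Iso 𝓒 𝓓 (f ↾ X') X' Y')
    iso-reverse {f} {X} {Y} {X'} {e} {y} stC stD cY i s fey
      with remove-maximal 𝓓 stD cY (image-maximal i s fey)
    ... | Y' , cY' , Y'=Y-y =
          Y' , removal-step 𝓓 cY' cY Y'=Y-y y∈Y ,
          iso-restrict stC stD i (step-target 𝓒 s) cY (step-source 𝓒 s) cY'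
            (step-⊆ 𝓒 s) (remove-⊆ 𝓓 Y'=Y-y) (λ d y' p → mk⇔ (to d y' p) (from d y' p))
      where
      y∈Y : y ∈ Y
      y∈Y = proj₂ (Iso.dom⊆ i e y fey)
      to : ∀ d y' → f d y' → d ∈ X' → y' ∈ Y'
      to d y' p d∈X' = remove-keeps 𝓓 Y'=Y-y (proj₂ (Iso.dom⊆ i d y' p))
        λ { refl → step-new∉ 𝓒 s (subst (_∈ X') (Iso.inj i d e y' p fey) d∈X') }
      from : ∀ d y' → f d y' → y' ∈ Y' → d ∈ X'
      from d y' p y'∈Y' with step-old 𝓒 s d (proj₁ (Iso.dom⊆ i d y' p))
      ... | inj₁ d∈X' = d∈X'
      ... | inj₂ refl = ⊥-elim (remove-∉ 𝓓 Y'=Y-y (subst (_∈ Y') (Iso.func i e y' y p fey) y'∈Y'))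

    declare-transfer : ∀ {f X Y x a φ ρ σ} → Iso 𝓒 𝓓 f X Y → RelEnv 𝓒 𝓓 f ([ x ∶ a ] φ) ρ σ →
                       (∀ {ρ' σ'} → RelEnv 𝓒 𝓓 f φ ρ' σ' → Sat 𝓒 X ρ' φ ⇔ Sat 𝓓 Y σ' φ) →
                       Sat 𝓒 X ρ ([ x ∶ a ] φ) ⇔ Sat 𝓓 Y σ ([ x ∶ a ] φ)
    declare-transfer {f} {x = x} {φ = φ} {ρ} {σ} i r body = mk⇔
      (λ (e , e∈X , ℓe , sat) → let (y , p) = Iso.total i e e∈X in
        y , proj₂ (Iso.dom⊆ i e y p) , trans (sym (Iso.labels i e y p)) ℓe , ⇒ (body (related e y p)) sat)
      (λ (y , y∈Y , ℓy , sat) → let (e , p) = Iso.surj i y y∈Y in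
        e , proj₁ (Iso.dom⊆ i e y p) , trans (Iso.labels i e y p) ℓy , ⇐ (body (related e y p)) sat)
      where
      related : ∀ e y → f e y → RelEnv 𝓒 𝓓 f φ (_[_↦_] 𝓒 ρ x e) (_[_↦_] 𝓓 σ x y)
      related e y p = rel-env-update x e y p (λ z q z≢x → fi-dec z≢x q) r

    reverse-transfer : ∀ {f X Y x φ ρ σ} → Stable 𝓒 → Stable 𝓓 → D.Conf Y → Iso 𝓒 𝓓 f X Y →
                       RelEnv 𝓒 𝓓 f (⟪ x ⟫ φ) ρ σ →
                       (∀ {X' Y' f'} → C.Conf X' → D.Conf Y' → Iso 𝓒 𝓓 f' X' Y' →
                          RelEnv 𝓒 𝓓 f' φ ρ σ → Sat 𝓒 X' ρ φ → Sat 𝓓 Y' σ φ) →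
                       Sat 𝓒 X ρ (⟪ x ⟫ φ) → Sat 𝓓 Y σ (⟪ x ⟫ φ)
    reverse-transfer {f} {x = x} {φ} {ρ} {σ} stC stD cY i r body (X' , e , s , ρx , perm , sat)
      with r x fi-revˡ
    ... | _ , y , ρx' , σx , fey with just-injective (trans (sym ρx) ρx')
    ... | refl with iso-reverse stC stD cY i s fey
    ... | Y' , s' , i' = Y' , y , s' , σx , permitted , body (step-source 𝓒 s) (step-source 𝓓 s') i' related sat
      where
      related : RelEnv 𝓒 𝓓 (f ↾ X') φ ρ σ
      related z q with r z (fi-revʳ q) | perm z q
      ... | d , y' , ρz , σz , p | _ , ρz' , d∈X' with just-injective (trans (sym ρz) ρz')
      ... | refl = d , y' , ρz , σz , p , d∈X'
      permitted : Permissible 𝓓 φ Y' σ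
      permitted z q = let (d , y' , _ , σz , p) = related z q in y' , σz , proj₂ (Iso.dom⊆ i' d y' p)

  module _ {Act : Set} {𝓒 𝓓 : ConfStructure Act} (stC : Stable 𝓒) (stD : Stable 𝓓) where
    private
      module C = ConfStructure 𝓒
      module D = ConfStructure 𝓓

    ro-invariance : ∀ {φ} → IsRO φ → ∀ {X Y f ρ σ} → C.Conf X → D.Conf Y → Iso 𝓒 𝓓 f X Y →
                    RelEnv 𝓒 𝓓 f φ ρ σ → Sat 𝓒 X ρ φ ⇔ Sat 𝓓 Y σ φ
    ro-invariance ro-tt cX cY i r = ⇔.refl
    ro-invariance (ro-¬ p) cX cY i r = ¬-cong-⇔ (ro-invariance p cX cY i λ x q → r x (fi-¬ q))
    ro-invariance (ro-∧ p q) cX cY i r =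
      ro-invariance p cX cY i (λ x w → r x (fi-∧ˡ w)) ×-⇔ ro-invariance q cX cY i (λ x w → r x (fi-∧ʳ w))
    ro-invariance (ro-dec p) cX cY i r = declare-transfer i r (ro-invariance p cX cY i)
    ro-invariance (ro-rev p) cX cY i r = mk⇔
      (reverse-transfer stC stD cY i r λ cX' cY' i' r' → ⇒ (ro-invariance p cX' cY' i' r'))
      (reverse-transfer stD stC cX (iso-flip i) (rel-env-flip {𝓒 = 𝓓} {𝓓 = 𝓒} r) λ cY' cX' i' r' →
        ⇐ (ro-invariance p cX' cY' (iso-flip i') (rel-env-flip {𝓒 = 𝓒} {𝓓 = 𝓓} r')))

  module _ {Act : Set} {𝓒 𝓓 : ConfStructure Act} where
    private
      module C = ConfStructure 𝓒
      module D = ConfStructure 𝓓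

    new-events-related : ∀ {f f' X Y X' Y' e e'} → Iso 𝓒 𝓓 f X Y → Iso 𝓒 𝓓 f' X' Y' →
                         RestrictsTo 𝓒 𝓓 f' X f → Step 𝓒 X e X' → Step 𝓓 Y e' Y' → f' e e'
    new-events-related {f' = f'} {e = e} {e'} i i' res sX sY with Iso.total i' e (step-new∈ 𝓒 sX)
    ... | y , f'ey with step-old 𝓓 sY y (proj₂ (Iso.dom⊆ i' e y f'ey))
    ... | inj₂ refl = f'ey
    ... | inj₁ y∈Y with Iso.surj i y y∈Y
    ... | d , fdy with Iso.inj i' d e y (proj₁ (⇐ (res d y) fdy)) f'ey
    ... | refl = ⊥-elim (step-new∉ 𝓒 sX (proj₁ (Iso.dom⊆ i d y fdy)))

    bisim-flip : ∀ {R : Triple 𝓒 𝓓} → IsHBisim 𝓒 𝓓 R → IsHBisim 𝓓 𝓒 (λ Y X g → R X Y (flip g))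
    bisim-flip {R} b = record
      { init = IsHBisim.init b
      ; confs = λ r → proj₂ (IsHBisim.confs b r) , proj₁ (IsHBisim.confs b r)
      ; iso = λ r → iso-flip (IsHBisim.iso b r)
      ; forth = λ r a Y' s → let (X' , f' , s' , r' , res) = IsHBisim.back b r a Y' s in
                             X' , flip f' , s' , r' , swap-restriction r r' res
      ; back = λ r a X' s → let (Y' , f' , s' , r' , res) = IsHBisim.forth b r a X' s in
                            Y' , flip f' , s' , r' , swap-restriction r r' res }
      where
      swap-restriction : ∀ {X Y X' Y' f' g} → R X Y (flip g) → R X' Y' f' →
                         RestrictsTo 𝓒 𝓓 f' X (flip g) → RestrictsTo 𝓓 𝓒 (flip f') Y g
      swap-restriction r r' res y d = restricts-codomain (IsHBisim.iso b r') (IsHBisim.iso b r) res d y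

    forward-transfer : ∀ {R} → IsHBisim 𝓒 𝓓 R → ∀ {x a φ X Y f ρ σ} → R X Y f →
                       RelEnv 𝓒 𝓓 f (⟨ x ∶ a ⟩ φ) ρ σ →
                       (∀ {X' Y' f' ρ' σ'} → R X' Y' f' → RelEnv 𝓒 𝓓 f' φ ρ' σ' →
                          Sat 𝓒 X' ρ' φ → Sat 𝓓 Y' σ' φ) →
                       Sat 𝓒 X ρ (⟨ x ∶ a ⟩ φ) → Sat 𝓓 Y σ (⟨ x ∶ a ⟩ φ)
    forward-transfer b {x} {φ = φ} {ρ = ρ} {σ} r rel body (X' , e , sX , ℓe , sat)
      with IsHBisim.forth b r _ X' (e , sX , ℓe)
    ... | Y' , f' , (e' , sY , ℓe') , r' , res = Y' , e' , sY , ℓe' , body r' related sat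
      where
      f'ee' : f' e e'
      f'ee' = new-events-related (IsHBisim.iso b r) (IsHBisim.iso b r') res sX sY
      related : RelEnv 𝓒 𝓓 f' φ (_[_↦_] 𝓒 ρ x e) (_[_↦_] 𝓓 σ x e')
      related = rel-env-update x e e' f'ee' (λ z q z≢x → fi-fwd z≢x q)
        λ z q → let (d , y , ρz , σz , p) = rel z q in d , y , ρz , σz , proj₁ (⇐ (res d y) p)

  module _ {Act : Set} {𝓒 𝓓 : ConfStructure Act} (stC : Stable 𝓒) (stD : Stable 𝓓)
           {R : Triple 𝓒 𝓓} (b : IsHBisim 𝓒 𝓓 R) where

    h-invariance : ∀ {φ} → IsH φ → ∀ {X Y f ρ σ} → R X Y f → RelEnv 𝓒 𝓓 f φ ρ σ →
                   Sat 𝓒 X ρ φ ⇔ Sat 𝓓 Y σ φ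
    h-invariance h-tt r rel = ⇔.refl
    h-invariance (h-¬ p) r rel = ¬-cong-⇔ (h-invariance p r λ x q → rel x (fi-¬ q))
    h-invariance (h-∧ p q) r rel =
      h-invariance p r (λ x w → rel x (fi-∧ˡ w)) ×-⇔ h-invariance q r (λ x w → rel x (fi-∧ʳ w))
    h-invariance (h-fwd p) r rel = mk⇔
      (forward-transfer b r rel λ r' rel' → ⇒ (h-invariance p r' rel'))
      (forward-transfer (bisim-flip b) r (rel-env-flip {𝓒 = 𝓓} {𝓓 = 𝓒} rel) λ r' rel' →
        ⇐ (h-invariance p r' (rel-env-flip {𝓒 = 𝓒} {𝓓 = 𝓓} rel')))
    h-invariance (h-dec p) r rel = declare-transfer (IsHBisim.iso b r) rel (h-invariance p r)
    h-invariance (h-ro p) r rel =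
      ro-invariance stC stD p (proj₁ (IsHBisim.confs b r)) (proj₂ (IsHBisim.confs b r)) (IsHBisim.iso b r) rel

  soundness : ∀ {Act} {𝓒 𝓓 : ConfStructure Act} → Stable 𝓒 → Stable 𝓓 →
              HBisimilar 𝓒 𝓓 → EquivH 𝓒 𝓓
  soundness stC stD (R , b) φ h closed =
    h-invariance stC stD b h (IsHBisim.init b) (λ x q → ⊥-elim (closed x q))

  -- The number of entries of the list B that lie in V.  For V ⊆ B this measures the size of
  -- the set V, and it strictly decreases when an event is removed.
  count : {E : Set} → List E → List E → ℕ
  count [] V = 0
  count (x ∷ B) V with dec (x ∈ V)
  ... | yes _ = suc (count B V)
  ... | no _ = count B V

  count-mono : {E : Set} (B : List E) {U V : List E} → U ⊆ V → count B U ≤ count B V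
  count-mono [] U⊆V = z≤n
  count-mono (x ∷ B) {U} {V} U⊆V with dec (x ∈ U) | dec (x ∈ V)
  ... | yes _ | yes _ = s≤s (count-mono B U⊆V)
  ... | yes x∈U | no x∉V = ⊥-elim (x∉V (U⊆V x x∈U))
  ... | no _ | yes _ = ≤-trans (count-mono B U⊆V) (n≤1+n _)
  ... | no _ | no _ = count-mono B U⊆V

  count-strict : {E : Set} (B : List E) {U V : List E} {y : E} → U ⊆ V → y ∈ B → y ∈ V → y ∉ U →
                 count B U < count B V
  count-strict (x ∷ B) {U} {V} U⊆V (here refl) y∈V y∉U with dec (x ∈ U) | dec (x ∈ V)
  ... | yes x∈U | _ = ⊥-elim (y∉U x∈U)
  ... | no _ | yes _ = s≤s (count-mono B U⊆V)
  ... | no _ | no x∉V = ⊥-elim (x∉V y∈V)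
  count-strict (x ∷ B) {U} {V} U⊆V (there y∈B) y∈V y∉U with dec (x ∈ U) | dec (x ∈ V)
  ... | yes _ | yes _ = s≤s (count-strict B U⊆V y∈B y∈V y∉U)
  ... | yes x∈U | no x∉V = ⊥-elim (x∉V (U⊆V x x∈U))
  ... | no _ | yes _ = <-≤-trans (count-strict B U⊆V y∈B y∈V y∉U) (n≤1+n _)
  ... | no _ | no _ = count-strict B U⊆V y∈B y∈V y∉U

  count-positive : {E : Set} (B : List E) {V : List E} {y : E} → y ∈ B → y ∈ V → 0 < count B V
  count-positive B y∈B y∈V = ≤-trans (s≤s z≤n) (count-strict B {U = []} (λ _ ()) y∈B y∈V λ ())

  count-bound : {E : Set} (B V : List E) → count B V ≤ length B
  count-bound [] V = z≤n
  count-bound (x ∷ B) V with dec (x ∈ V)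
  ... | yes _ = s≤s (count-bound B V)
  ... | no _ = ≤-trans (count-bound B V) (n≤1+n _)

  module _ {Act : Set} {𝓒 : ConfStructure Act} (st : Stable 𝓒) where
    open ConfStructure 𝓒
    open Stable st

    count-remove : ∀ {B U V y k} → V ⊆ B → y ∈ V → IsRemove 𝓒 U V y → count B V ≤ suc k → count B U ≤ k
    count-remove {B} V⊆B y∈V U=V-y bound =
      ≤-pred (<-≤-trans (count-strict B (remove-⊆ 𝓒 U=V-y) (V⊆B _ y∈V) y∈V (remove-∉ 𝓒 U=V-y)) bound)

    restore : ∀ {V W U U₂ y y'} → Conf V → Conf W → Conf U₂ → W ⊆ V → y ∈ W → y' ∉ W →
              IsRemove 𝓒 U V y → IsRemove 𝓒 U₂ U y' → ∃[ V' ] (Conf V' × IsRemove 𝓒 V' V y')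
    restore {V} {W} {U} {U₂} {y} {y'} cV cW cU₂ W⊆V y∈W y'∉W U=V-y U₂=U-y'
      with union-conf U₂ W V cU₂ cW cV (λ d p → remove-⊆ 𝓒 U=V-y d (remove-⊆ 𝓒 U₂=U-y' d p)) W⊆V
    ... | V' , cV' , V'=U₂∪W = V' , cV' , λ d → mk⇔ (to d) (from d)
      where
      to : ∀ d → d ∈ V' → d ∈ V × d ≢ y'
      to d p with ⇒ (V'=U₂∪W d) p
      ... | inj₁ d∈U₂ = remove-⊆ 𝓒 U=V-y d (remove-⊆ 𝓒 U₂=U-y' d d∈U₂) , λ { refl → remove-∉ 𝓒 U₂=U-y' d∈U₂ }
      ... | inj₂ d∈W = W⊆V d d∈W , λ { refl → y'∉W d∈W }
      from : ∀ d → d ∈ V × d ≢ y' → d ∈ V'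
      from d (d∈V , d≢y') with dec (d ≡ y)
      ... | yes refl = ⇐ (V'=U₂∪W d) (inj₂ y∈W)
      ... | no d≢y = ⇐ (V'=U₂∪W d) (inj₁ (remove-keeps 𝓒 U₂=U-y' (remove-keeps 𝓒 U=V-y d∈V d≢y) d≢y'))

    -- By induction on the size of V: if the event removable by rootedness lies in W, recurse
    -- on V ∖ {y} and W ∩ (V ∖ {y}), then put y back with restore.
    removable-outside : ∀ n B {V W z} → Conf V → Conf W → W ⊆ V → V ⊆ B → z ∈ V → z ∉ W →
                        count B V ≤ n → ∃[ y ] (y ∈ V × y ∉ W × ∃[ U ] (Conf U × IsRemove 𝓒 U V y))
    removable-outside zero B _ _ _ V⊆B z∈V _ bound =
      ⊥-elim (n≮0 (<-≤-trans (count-positive B (V⊆B _ z∈V) z∈V) bound))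
    removable-outside (suc n) B {V} {W} {z} cV cW W⊆V V⊆B z∈V z∉W bound
      with rooted V cV (z , z∈V)
    ... | y , y∈V , U , cU , U=V-y with dec (y ∈ W)
    ...   | no y∉W = y , y∈V , y∉W , U , cU , U=V-y
    ...   | yes y∈W =
      let U⊆V : U ⊆ V
          U⊆V = remove-⊆ 𝓒 U=V-y
          (W₁ , cW₁ , W₁=W∩U) = inter-conf W U V cW cU cV W⊆V U⊆V
          z∈U : z ∈ U
          z∈U = remove-keeps 𝓒 U=V-y z∈V λ { refl → z∉W y∈W }
          (y' , y'∈U , y'∉W₁ , U₂ , cU₂ , U₂=U-y') =
            removable-outside n B cU cW₁ (λ d p → proj₂ (⇒ (W₁=W∩U d) p)) (λ d p → V⊆B d (U⊆V d p))
              z∈U (λ p → z∉W (proj₁ (⇒ (W₁=W∩U z) p))) (count-remove V⊆B y∈V U=V-y bound)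
          y'∉W : y' ∉ W
          y'∉W p = y'∉W₁ (⇐ (W₁=W∩U y') (p , y'∈U))
      in y' , U⊆V y' y'∈U , y'∉W , restore cV cW cU₂ W⊆V y∈W y'∉W U=V-y U₂=U-y'

  module _ {Act : Set} where
    ff : Form Act
    ff = ¬' tt

    _∨'_ : Form Act → Form Act → Form Act
    φ ∨' ψ = ¬' ((¬' φ) ∧' (¬' ψ))

    -- A tautology whose only free identifier is xe.  Under ⟪ xd ⟫ it requires, through
    -- permissibility, that the event named xe survives the reversal of the event named xd.
    mentions : Ident → Form Act
    mentions xe = ¬' (ff ∧' (⟪ xe ⟫ tt))

    some-reversal : Ident → List Act → Form Act → Form Act
    some-reversal z [] ψ = ff
    some-reversal z (b ∷ bs) ψ = ([ z ∶ b ] ⟪ z ⟫ ψ) ∨' some-reversal z bs ψ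

    -- After reversing fewer than k events with labels in labs, the event named xd can be
    -- reversed while the event named xe remains.
    separation : List Act → Ident → Ident → Ident → ℕ → Form Act
    separation labs xd xe z zero = ff
    separation labs xd xe z (suc k) =
      (⟪ xd ⟫ mentions xe) ∨' some-reversal z labs (separation labs xd xe z k)

    separation-ro : ∀ labs xd xe z k → IsRO (separation labs xd xe z k)
    separation-ro labs xd xe z zero = ro-¬ ro-tt
    separation-ro labs xd xe z (suc k) =
      ro-¬ (ro-∧ (ro-¬ (ro-rev mentions-ro)) (ro-¬ (some-reversal-ro labs)))
      where
      mentions-ro : IsRO (mentions xe)
      mentions-ro = ro-¬ (ro-∧ (ro-¬ ro-tt) (ro-rev ro-tt))
      some-reversal-ro : ∀ bs → IsRO (some-reversal z bs (separation labs xd xe z k))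
      some-reversal-ro [] = ro-¬ ro-tt
      some-reversal-ro (b ∷ bs) =
        ro-¬ (ro-∧ (ro-¬ (ro-dec (ro-rev (separation-ro labs xd xe z k)))) (ro-¬ (some-reversal-ro bs)))

    mentions-free : ∀ {y xe} → FreeIn y (mentions xe) → y ≡ xe
    mentions-free (fi-¬ (fi-∧ˡ (fi-¬ ())))
    mentions-free (fi-¬ (fi-∧ʳ fi-revˡ)) = refl
    mentions-free (fi-¬ (fi-∧ʳ (fi-revʳ ())))

    some-reversal-free : ∀ {y z ψ} bs → FreeIn y (some-reversal z bs ψ) → FreeIn y ψ
    some-reversal-free [] (fi-¬ ())
    some-reversal-free (b ∷ bs) (fi-¬ (fi-∧ˡ (fi-¬ (fi-dec y≢z fi-revˡ)))) = ⊥-elim (y≢z refl)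
    some-reversal-free (b ∷ bs) (fi-¬ (fi-∧ˡ (fi-¬ (fi-dec _ (fi-revʳ q))))) = q
    some-reversal-free (b ∷ bs) (fi-¬ (fi-∧ʳ (fi-¬ q))) = some-reversal-free bs q

    separation-free : ∀ {y} labs xd xe z k → FreeIn y (separation labs xd xe z k) → y ≡ xd ⊎ y ≡ xe
    separation-free labs xd xe z zero (fi-¬ ())
    separation-free labs xd xe z (suc k) (fi-¬ (fi-∧ˡ (fi-¬ fi-revˡ))) = inj₁ refl
    separation-free labs xd xe z (suc k) (fi-¬ (fi-∧ˡ (fi-¬ (fi-revʳ q)))) = inj₂ (mentions-free q)
    separation-free labs xd xe z (suc k) (fi-¬ (fi-∧ʳ (fi-¬ q))) =
      separation-free labs xd xe z k (some-reversal-free labs q)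

  module _ {Act : Set} (𝓒 : ConfStructure Act) where
    open ConfStructure 𝓒

    reversal-sound : ∀ {V ρ d e xd xe} → ρ xd ≡ just d → ρ xe ≡ just e →
                     Sat 𝓒 V ρ (⟪ xd ⟫ mentions xe) → ¬ Leq 𝓒 V d e
    reversal-sound {xe = xe} ρxd ρxe (_ , _ , s , ρxd' , permitted , _) d≤e
      with just-injective (trans (sym ρxd') ρxd) | permitted xe (fi-¬ (fi-∧ʳ fi-revˡ))
    ... | refl | _ , ρxe' , e∈V' with just-injective (trans (sym ρxe') ρxe)
    ... | refl = new-not-below 𝓒 s e∈V' d≤e

    some-reversal-sound : ∀ {d e xd xe z ψ} → xd ≢ z → xe ≢ z →
                          (∀ {V ρ} → ρ xd ≡ just d → ρ xe ≡ just e → Sat 𝓒 V ρ ψ → ¬ Leq 𝓒 V d e) →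
                          ∀ bs {V ρ} → ρ xd ≡ just d → ρ xe ≡ just e →
                          Sat 𝓒 V ρ (some-reversal z bs ψ) → ¬ Leq 𝓒 V d e
    some-reversal-sound _ _ body [] _ _ sat _ = sat record {}
    some-reversal-sound {xd = xd} {xe} {z} {ψ} xd≢z xe≢z body (b ∷ bs) {V} {ρ} ρxd ρxe sat d≤e =
      sat (first , λ sat' → some-reversal-sound xd≢z xe≢z body bs ρxd ρxe sat' d≤e)
      where
      first : ¬ Sat 𝓒 V ρ ([ z ∶ b ] ⟪ z ⟫ ψ)
      first (y , _ , _ , _ , _ , s , _ , _ , sat') =
        body (trans (update-there 𝓒 ρ z y xd≢z) ρxd) (trans (update-there 𝓒 ρ z y xe≢z) ρxe) sat'
          (leq-shrink 𝓒 (step-⊆ 𝓒 s) d≤e)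

    separation-sound : ∀ labs xd xe z k {V ρ d e} → xd ≢ z → xe ≢ z → ρ xd ≡ just d → ρ xe ≡ just e →
                       Sat 𝓒 V ρ (separation labs xd xe z k) → ¬ Leq 𝓒 V d e
    separation-sound labs xd xe z zero _ _ _ _ sat _ = sat record {}
    separation-sound labs xd xe z (suc k) xd≢z xe≢z ρxd ρxe sat d≤e =
      sat ((λ rev → reversal-sound ρxd ρxe rev d≤e) ,
           λ some → some-reversal-sound xd≢z xe≢z (separation-sound labs xd xe z k xd≢z xe≢z)
                      labs ρxd ρxe some d≤e)

    some-reversal-intro : ∀ {z V ρ ψ} bs {b} → b ∈ bs → Sat 𝓒 V ρ ([ z ∶ b ] ⟪ z ⟫ ψ) →
                          Sat 𝓒 V ρ (some-reversal z bs ψ)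
    some-reversal-intro (b ∷ bs) (here refl) sat (¬sat , _) = ¬sat sat
    some-reversal-intro (b ∷ bs) (there b∈bs) sat (_ , ¬sat) = ¬sat (some-reversal-intro bs b∈bs sat)

    module _ (st : Stable 𝓒) where

      reversal-complete : ∀ {V U ρ d e xd xe} → ρ xd ≡ just d → ρ xe ≡ just e → Conf V → Conf U →
                          IsRemove 𝓒 U V d → d ∈ V → e ∈ U → Sat 𝓒 V ρ (⟪ xd ⟫ mentions xe)
      reversal-complete {U = U} {ρ} {e = e} {xe = xe} ρxd ρxe cV cU U=V-d d∈V e∈U =
        U , _ , removal-step 𝓒 cU cV U=V-d d∈V , ρxd , permitted , λ (¬⊤ , _) → ¬⊤ record {}
        where
        permitted : Permissible 𝓒 (mentions xe) U ρ
        permitted y q with mentions-free q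
        ... | refl = e , ρxe , e∈U

      -- Conversely, if a configuration W ⊆ V contains e but not d, the separation formula
      -- holds once k bounds the size of V: peel off events of V ∖ W (removable-outside)
      -- until d itself is reversed.
      separation-complete : ∀ labs xd xe z k B {V W ρ d e} → xd ≢ z → xe ≢ z →
                            ρ xd ≡ just d → ρ xe ≡ just e → Conf V → V ⊆ B → d ∈ V →
                            Conf W → W ⊆ V → e ∈ W → d ∉ W → (∀ y → y ∈ V → ℓ y ∈ labs) →
                            count B V ≤ k → Sat 𝓒 V ρ (separation labs xd xe z k)
      separation-complete labs xd xe z zero B _ _ _ _ _ V⊆B d∈V _ _ _ _ _ bound =
        ⊥-elim (n≮0 (<-≤-trans (count-positive B (V⊆B _ d∈V) d∈V) bound))
      separation-complete labs xd xe z (suc k) B {V} {W} {ρ} {d} {e}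
                          xd≢z xe≢z ρxd ρxe cV V⊆B d∈V cW W⊆V e∈W d∉W labelled bound
        with removable-outside st (suc k) B cV cW W⊆V V⊆B d∈V d∉W bound
      ... | y , y∈V , y∉W , U , cU , U=V-y with dec (y ≡ d)
      ...   | yes refl = λ (¬rev , _) →
                ¬rev (reversal-complete ρxd ρxe cV cU U=V-y y∈V (remove-outside 𝓒 U=V-y W⊆V y∉W e e∈W))
      ...   | no y≢d = λ (_ , ¬some) → ¬some (some-reversal-intro labs (labelled y y∈V)
                (y , y∈V , refl , U , y , removal-step 𝓒 cU cV U=V-y y∈V , update-here 𝓒 ρ z y ,
                 permitted , recurse))
        where
        ρ' : Env 𝓒
        ρ' = _[_↦_] 𝓒 ρ z y
        ρ'xd : ρ' xd ≡ just d
        ρ'xd = trans (update-there 𝓒 ρ z y xd≢z) ρxd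
        ρ'xe : ρ' xe ≡ just e
        ρ'xe = trans (update-there 𝓒 ρ z y xe≢z) ρxe
        W⊆U : W ⊆ U
        W⊆U = remove-outside 𝓒 U=V-y W⊆V y∉W
        d∈U : d ∈ U
        d∈U = remove-keeps 𝓒 U=V-y d∈V λ d≡y → y≢d (sym d≡y)
        permitted : Permissible 𝓒 (separation labs xd xe z k) U ρ'
        permitted v q with separation-free labs xd xe z k q
        ... | inj₁ refl = d , ρ'xd , d∈U
        ... | inj₂ refl = e , ρ'xe , W⊆U e e∈W
        recurse : Sat 𝓒 U ρ' (separation labs xd xe z k)
        recurse = separation-complete labs xd xe z k B xd≢z xe≢z ρ'xd ρ'xe cU
                    (λ g p → V⊆B g (remove-⊆ 𝓒 U=V-y g p)) d∈U cW W⊆U e∈W d∉W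
                    (λ g p → labelled g (remove-⊆ 𝓒 U=V-y g p)) (count-remove st V⊆B y∈V U=V-y bound)

      leq-iff-unseparated : ∀ labs xd xe z k {V ρ d e} → xd ≢ z → xe ≢ z → ρ xd ≡ just d →
                            ρ xe ≡ just e → Conf V → d ∈ V → (∀ y → y ∈ V → ℓ y ∈ labs) →
                            count V V ≤ k → Leq 𝓒 V d e ⇔ (¬ Sat 𝓒 V ρ (separation labs xd xe z k))
      leq-iff-unseparated labs xd xe z k xd≢z xe≢z ρxd ρxe cV d∈V labelled bound = mk⇔
        (λ d≤e sat → separation-sound labs xd xe z k xd≢z xe≢z ρxd ρxe sat d≤e)
        (λ unseparated → dne λ d≰e → let (W , cW , W⊆V , e∈W , d∉W) = avoiding-witness 𝓒 d≰e in
          unseparated (separation-complete labs xd xe z k _ xd≢z xe≢z ρxd ρxe cV (λ _ p → p) d∈V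
                         cW W⊆V e∈W d∉W labelled bound))

  sat-transport : ∀ {Act} (𝓒 : ConfStructure Act) φ {X₁ X₂ ρ} → ConfStructure.Conf 𝓒 X₁ →
                  ConfStructure.Conf 𝓒 X₂ → X₁ ⊆ X₂ → X₂ ⊆ X₁ → Sat 𝓒 X₁ ρ φ → Sat 𝓒 X₂ ρ φ
  sat-transport 𝓒 tt c₁ c₂ X₁⊆X₂ X₂⊆X₁ sat = sat
  sat-transport 𝓒 (¬' φ) c₁ c₂ X₁⊆X₂ X₂⊆X₁ ¬sat sat = ¬sat (sat-transport 𝓒 φ c₂ c₁ X₂⊆X₁ X₁⊆X₂ sat)
  sat-transport 𝓒 (φ ∧' ψ) c₁ c₂ X₁⊆X₂ X₂⊆X₁ (sat , sat') =
    sat-transport 𝓒 φ c₁ c₂ X₁⊆X₂ X₂⊆X₁ sat , sat-transport 𝓒 ψ c₁ c₂ X₁⊆X₂ X₂⊆X₁ sat'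
  sat-transport 𝓒 (⟨ x ∶ a ⟩ φ) c₁ c₂ X₁⊆X₂ X₂⊆X₁ (X' , e , (_ , cX' , X₁⊆X' , e∈X' , e∉X₁ , old) , rest) =
    X' , e , (c₂ , cX' , (λ d p → X₁⊆X' d (X₂⊆X₁ d p)) , e∈X' , (λ p → e∉X₁ (X₂⊆X₁ _ p)) ,
              λ d p → map₁ (X₁⊆X₂ d) (old d p)) , rest
  sat-transport 𝓒 ([ x ∶ a ] φ) c₁ c₂ X₁⊆X₂ X₂⊆X₁ (e , e∈X₁ , ℓe , sat) =
    e , X₁⊆X₂ e e∈X₁ , ℓe , sat-transport 𝓒 φ c₁ c₂ X₁⊆X₂ X₂⊆X₁ sat
  sat-transport 𝓒 (⟪ x ⟫ φ) c₁ c₂ X₁⊆X₂ X₂⊆X₁ (X' , e , (cX' , _ , X'⊆X₁ , e∈X₁ , e∉X' , old) , rest) =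
    X' , e , (cX' , c₂ , (λ d p → X₁⊆X₂ d (X'⊆X₁ d p)) , X₁⊆X₂ e e∈X₁ , e∉X' ,
              λ d p → old d (X₂⊆X₁ d p)) , rest

  Scoped : ∀ {Act} → ℕ → Form Act → Set
  Scoped N φ = ∀ x → FreeIn x φ → x < N

  EquivBelow : ∀ {Act} (𝓒 𝓓 : ConfStructure Act) → List (ConfStructure.Event 𝓒) →
               List (ConfStructure.Event 𝓓) → Env 𝓒 → Env 𝓓 → ℕ → Set
  EquivBelow {Act} 𝓒 𝓓 X Y ρ σ N =
    ∀ (φ : Form Act) → IsH φ → Scoped N φ → Sat 𝓒 X ρ φ ⇔ Sat 𝓓 Y σ φ

  record Naming {Act} (𝓒 𝓓 : ConfStructure Act) (f : Rel 𝓒 𝓓) (X : List (ConfStructure.Event 𝓒))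
                (Y : List (ConfStructure.Event 𝓓)) (ρ : Env 𝓒) (σ : Env 𝓓) (N : ℕ) : Set where
    field
      ρ→σ : ∀ k d → ρ k ≡ just d → ∃[ y ] (σ k ≡ just y × f d y)
      σ→ρ : ∀ k y → σ k ≡ just y → ∃[ d ] (ρ k ≡ just d × f d y)
      ρ-covers : ∀ d → d ∈ X → ∃[ k ] (ρ k ≡ just d)
      σ-covers : ∀ y → y ∈ Y → ∃[ k ] (σ k ≡ just y)
      ρ-below : ∀ k → N ≤ k → ρ k ≡ nothing
      σ-below : ∀ k → N ≤ k → σ k ≡ nothing

  record Matched {Act} (𝓒 𝓓 : ConfStructure Act) (X : List (ConfStructure.Event 𝓒))
                 (Y : List (ConfStructure.Event 𝓓)) (f : Rel 𝓒 𝓓) : Set₁ where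
    field
      confX : ConfStructure.Conf 𝓒 X
      confY : ConfStructure.Conf 𝓓 Y
      iso : Iso 𝓒 𝓓 f X Y
      N : ℕ
      ρ : Env 𝓒
      σ : Env 𝓓
      naming : Naming 𝓒 𝓓 f X Y ρ σ N
      equiv : EquivBelow 𝓒 𝓓 X Y ρ σ N

  matched-flip : ∀ {Act} {𝓒 𝓓 : ConfStructure Act} {g : Rel 𝓓 𝓒} {X Y} →
                 Matched 𝓓 𝓒 Y X g → Matched 𝓒 𝓓 X Y (flip g)
  matched-flip m = record
    { confX = confY ; confY = confX ; iso = iso-flip iso ; N = N ; ρ = σ ; σ = ρ
    ; naming = record { ρ→σ = σ→ρ ; σ→ρ = ρ→σ ; ρ-covers = σ-covers ; σ-covers = ρ-covers
                      ; ρ-below = σ-below ; σ-below = ρ-below }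
    ; equiv = λ φ h scoped → ⇔.sym (equiv φ h scoped) }
    where
    open Matched m
    open Naming naming

  named-below : ∀ {A : Set} {τ : ℕ → Maybe A} {N k a} → (∀ k → N ≤ k → τ k ≡ nothing) →
                τ k ≡ just a → k < N
  named-below {N = N} {k} empty-from-N τk with N ≤? k
  ... | yes N≤k with trans (sym τk) (empty-from-N k N≤k)
  ...   | ()
  named-below _ _ | no N≰k = ≰⇒> N≰k

  module _ {Act : Set} (𝓒 : ConfStructure Act) {ρ : Env 𝓒} {N : ℕ}
           (empty-from-N : ∀ k → N ≤ k → ρ k ≡ nothing) where
    open ConfStructure 𝓒

    fresh-keeps : ∀ {k e d} → ρ k ≡ just d → _[_↦_] 𝓒 ρ N e k ≡ just d
    fresh-keeps {k} {e} ρk = trans (update-there 𝓒 ρ N e (<⇒≢ (named-below empty-from-N ρk))) ρk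

    fresh-empty : ∀ {e} k → suc N ≤ k → _[_↦_] 𝓒 ρ N e k ≡ nothing
    fresh-empty {e} k N<k =
      trans (update-there 𝓒 ρ N e λ k≡N → <⇒≢ N<k (sym k≡N)) (empty-from-N k (<⇒≤ N<k))

    fresh-covers : ∀ {X e X'} → Step 𝓒 X e X' → (∀ d → d ∈ X → ∃[ k ] (ρ k ≡ just d)) →
                   ∀ d → d ∈ X' → ∃[ k ] (_[_↦_] 𝓒 ρ N e k ≡ just d)
    fresh-covers {e = e} s covers d d∈X' with step-old 𝓒 s d d∈X'
    ... | inj₂ refl = N , update-here 𝓒 ρ N e
    ... | inj₁ d∈X = let (k , ρk) = covers d d∈X in k , fresh-keeps ρk

  naming-extend : ∀ {Act} {𝓒 𝓓 : ConfStructure Act} {f X Y ρ σ N e e' X' Y'} →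
                  Naming 𝓒 𝓓 f X Y ρ σ N → Step 𝓒 X e X' → Step 𝓓 Y e' Y' →
                  Naming 𝓒 𝓓 (extend f e e') X' Y' (_[_↦_] 𝓒 ρ N e) (_[_↦_] 𝓓 σ N e') (suc N)
  naming-extend {𝓒 = 𝓒} {𝓓} {f} {ρ = ρ} {σ} {N} {e} {e'} n sX sY = record
    { ρ→σ = ρ→σ' ; σ→ρ = σ→ρ'
    ; ρ-covers = fresh-covers 𝓒 ρ-below sX ρ-covers ; σ-covers = fresh-covers 𝓓 σ-below sY σ-covers
    ; ρ-below = fresh-empty 𝓒 ρ-below ; σ-below = fresh-empty 𝓓 σ-below }
    where
    open Naming n
    ρ→σ' : ∀ k d → _[_↦_] 𝓒 ρ N e k ≡ just d → ∃[ y ] (_[_↦_] 𝓓 σ N e' k ≡ just y × extend f e e' d y)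
    ρ→σ' k d ρ'k with k ≟ℕ N
    ... | yes refl = e' , refl , inj₂ (sym (just-injective ρ'k) , refl)
    ... | no _ = let (y , σk , p) = ρ→σ k d ρ'k in y , σk , inj₁ p
    σ→ρ' : ∀ k y → _[_↦_] 𝓓 σ N e' k ≡ just y → ∃[ d ] (_[_↦_] 𝓒 ρ N e k ≡ just d × extend f e e' d y)
    σ→ρ' k y σ'k with k ≟ℕ N
    ... | yes refl = e , refl , inj₂ (refl , sym (just-injective σ'k))
    ... | no _ = let (d , ρk , p) = σ→ρ k y σ'k in d , ρk , inj₁ p

  module _ {Act : Set} {𝓒 𝓓 : ConfStructure Act} (stC : Stable 𝓒) (stD : Stable 𝓓) where
    private
      module C = ConfStructure 𝓒
      module D = ConfStructure 𝓓

    -- When X —e→ X' and Y —e'→ Y' agree on EIL_h formulas over the names of f-related old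
    -- events and the fresh name N for the new ones, an old event d is below e iff its image is
    -- below e': both sides are the failure of one separation formula.
    new-order-matched : ∀ {f X Y ρ σ N e e' X' Y'} → Iso 𝓒 𝓓 f X Y → Naming 𝓒 𝓓 f X Y ρ σ N →
                        (sX : Step 𝓒 X e X') (sY : Step 𝓓 Y e' Y') → C.ℓ e ≡ D.ℓ e' →
                        EquivBelow 𝓒 𝓓 X' Y' (_[_↦_] 𝓒 ρ N e) (_[_↦_] 𝓓 σ N e') (suc N) →
                        ∀ d y → f d y → Lt 𝓒 X' d e ⇔ Lt 𝓓 Y' y e'
    new-order-matched {f} {X} {Y} {ρ} {σ} {N} {e} {e'} {X'} {Y'} i n sX sY ℓe≡ℓe' equiv d y fdy
      with Naming.ρ-covers n d (proj₁ (Iso.dom⊆ i d y fdy))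
    ... | k , ρk with Naming.ρ→σ n k d ρk
    ... | y₀ , σk , fdy₀ with Iso.func i d y₀ y fdy₀ fdy
    ... | refl = leq-matched ×-⇔ mk⇔ (λ _ → y≢e') (λ _ → d≢e)
      where
      d∈X : d ∈ X
      d∈X = proj₁ (Iso.dom⊆ i d y fdy)
      y∈Y : y ∈ Y
      y∈Y = proj₂ (Iso.dom⊆ i d y fdy)
      d≢e : d ≢ e
      d≢e refl = step-new∉ 𝓒 sX d∈X
      y≢e' : y ≢ e'
      y≢e' refl = step-new∉ 𝓓 sY y∈Y
      k<N : k < N
      k<N = named-below (Naming.ρ-below n) ρk
      labs : List Act
      labs = map C.ℓ X'
      K : ℕ
      K = length X' + length Y'
      separates : Form Act
      separates = separation labs k N (suc N) K
      scoped : Scoped (suc N) separates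
      scoped x q with separation-free labs k N (suc N) K q
      ... | inj₁ refl = m<n⇒m<1+n k<N
      ... | inj₂ refl = n<1+n N
      leq-matched : Leq 𝓒 X' d e ⇔ Leq 𝓓 Y' y e'
      leq-matched =
        ⇔.trans (leq-iff-unseparated 𝓒 stC labs k N (suc N) K (<⇒≢ (m<n⇒m<1+n k<N)) (<⇒≢ (n<1+n N))
                   (trans (update-there 𝓒 ρ N e (<⇒≢ k<N)) ρk) (update-here 𝓒 ρ N e) (step-target 𝓒 sX)
                   (step-⊆ 𝓒 sX d d∈X) (λ g → ∈-map⁺ C.ℓ) (≤-trans (count-bound X' X') (m≤m+n _ _)))
          (⇔.trans (¬-cong-⇔ (equiv separates (h-ro (separation-ro labs k N (suc N) K)) scoped))
            (⇔.sym (leq-iff-unseparated 𝓓 stD labs k N (suc N) K (<⇒≢ (m<n⇒m<1+n k<N)) (<⇒≢ (n<1+n N))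
                      (trans (update-there 𝓓 σ N e' (<⇒≢ k<N)) σk) (update-here 𝓓 σ N e') (step-target 𝓓 sY)
                      (step-⊆ 𝓓 sY y y∈Y) (labels-covered i sX sY ℓe≡ℓe') (≤-trans (count-bound Y' Y') (m≤n+m _ _)))))

    matched-extend : ∀ {f X Y e e' X' Y'} → (m : Matched 𝓒 𝓓 X Y f) →
                     (sX : Step 𝓒 X e X') (sY : Step 𝓓 Y e' Y') → C.ℓ e ≡ D.ℓ e' →
                     EquivBelow 𝓒 𝓓 X' Y' (_[_↦_] 𝓒 (Matched.ρ m) (Matched.N m) e)
                                          (_[_↦_] 𝓓 (Matched.σ m) (Matched.N m) e') (suc (Matched.N m)) →
                     Matched 𝓒 𝓓 X' Y' (extend f e e')
    matched-extend m sX sY ℓe≡ℓe' equiv' = record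
      { confX = step-target 𝓒 sX ; confY = step-target 𝓓 sY
      ; iso = iso-extend stC stD iso sX sY ℓe≡ℓe' (new-order-matched iso naming sX sY ℓe≡ℓe' equiv')
      ; N = suc N ; ρ = _[_↦_] 𝓒 ρ N _ ; σ = _[_↦_] 𝓓 σ N _
      ; naming = naming-extend naming sX sY ; equiv = equiv' }
      where open Matched m

  distinguishing : ∀ {Act} {𝓒 𝓓 : ConfStructure Act} {X Y ρ σ N} → ¬ EquivBelow 𝓒 𝓓 X Y ρ σ N →
                   ∃[ ψ ] (IsH ψ × Scoped N ψ × Sat 𝓒 X ρ ψ × ¬ Sat 𝓓 Y σ ψ)
  distinguishing {Act} {𝓒} {𝓓} {X} {Y} {ρ} {σ} {N} inequivalent
    with dec (∃[ φ ] (IsH φ × Scoped N φ × ¬ (Sat 𝓒 X ρ φ ⇔ Sat 𝓓 Y σ φ)))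
  ... | no none = ⊥-elim (inequivalent λ φ h scoped → dne λ differ → none (φ , h , scoped , differ))
  ... | yes (φ , h , scoped , differ) with dec (Sat 𝓒 X ρ φ)
  ...   | yes sat = φ , h , scoped , sat , λ sat' → differ (mk⇔ (λ _ → sat') (λ _ → sat))
  ...   | no ¬sat = ¬' φ , h-¬ h , (λ { x (fi-¬ q) → scoped x q }) , ¬sat ,
                    λ ¬sat' → differ (mk⇔ (λ sat → ⊥-elim (¬sat sat)) (λ sat' → ⊥-elim (¬sat' sat')))

  -- If no a-successor of Y matches the successor X —e→ X' (with the fresh name N), then the
  -- conjunction Ψ of formulas refuting each of the finitely many a-successors makes ⟨N : a⟩Ψ
  -- distinguish X from Y, which is absurd.
  module Unmatched {Act : Set} {𝓒 𝓓 : ConfStructure Act} (image-finite : ImageFinite 𝓓)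
                   {X Y f} (m : Matched 𝓒 𝓓 X Y f) {e X' a} (sX : Step 𝓒 X e X')
                   (ℓe : ConfStructure.ℓ 𝓒 e ≡ a) where
    open Matched m
    private
      module D = ConfStructure 𝓓

    ρ' : Env 𝓒
    ρ' = _[_↦_] 𝓒 ρ N e

    σ' : D.Event → Env 𝓓
    σ' e' = _[_↦_] 𝓓 σ N e'

    module _ (none : ¬ (∃[ Y' ] ∃[ e' ] (Step 𝓓 Y e' Y' × D.ℓ e' ≡ a ×
                                          EquivBelow 𝓒 𝓓 X' Y' ρ' (σ' e') (suc N)))) where

      Refutes : List D.Event → Form Act → Set
      Refutes L ψ = ∀ Y' e' → Step 𝓓 Y e' Y' → D.ℓ e' ≡ a → (∀ d → d ∈ Y' ⇔ d ∈ L) →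
                    ¬ Sat 𝓓 Y' (σ' e') ψ

      refuter : ∀ L → ∃[ ψ ] (IsH ψ × Scoped (suc N) ψ × Sat 𝓒 X' ρ' ψ × Refutes L ψ)
      refuter L with dec (∃[ Y₁ ] ∃[ e₁ ] (Step 𝓓 Y e₁ Y₁ × D.ℓ e₁ ≡ a × (∀ d → d ∈ Y₁ ⇔ d ∈ L)))
      ... | no nothing-at-L =
            tt , h-tt , (λ _ ()) , _ , λ Y' e' s ℓe' Y'=L _ → nothing-at-L (Y' , e' , s , ℓe' , Y'=L)
      ... | yes (Y₁ , e₁ , s₁ , ℓe₁ , Y₁=L) with distinguishing (λ equiv₁ → none (Y₁ , e₁ , s₁ , ℓe₁ , equiv₁))
      ...   | ψ , h , scoped , sat , ¬sat₁ = ψ , h , scoped , sat , refutes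
        where
        refutes : Refutes L ψ
        refutes Y' e' s ℓe' Y'=L sat' with step-event-unique 𝓓 s s₁ (λ d p → ⇐ (Y'=L d) (⇒ (Y₁=L d) p))
        ... | refl = ¬sat₁ (sat-transport 𝓓 ψ (step-target 𝓓 s) (step-target 𝓓 s₁)
                              (λ d p → ⇐ (Y₁=L d) (⇒ (Y'=L d) p)) (λ d p → ⇐ (Y'=L d) (⇒ (Y₁=L d) p)) sat')

      refuter-all : ∀ Ls → ∃[ Ψ ] (IsH Ψ × Scoped (suc N) Ψ × Sat 𝓒 X' ρ' Ψ × (∀ L → L ∈ Ls → Refutes L Ψ))
      refuter-all [] = tt , h-tt , (λ _ ()) , _ , λ _ ()
      refuter-all (L ∷ Ls) with refuter L | refuter-all Ls
      ... | ψ , h , scoped , sat , refutes | Ψ , h' , scoped' , sat' , refutes' =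
            ψ ∧' Ψ , h-∧ h h' , (λ { x (fi-∧ˡ q) → scoped x q ; x (fi-∧ʳ q) → scoped' x q }) , (sat , sat') ,
            λ { L' (here refl) Y' e' s ℓe' Y'=L (sat'' , _) → refutes Y' e' s ℓe' Y'=L sat''
              ; L' (there p) Y' e' s ℓe' Y'=L (_ , sat'') → refutes' L' p Y' e' s ℓe' Y'=L sat'' }

      absurd : ⊥
      absurd with image-finite Y a
      ... | Ls , represented with refuter-all Ls
      ... | Ψ , h , scoped , sat , refutes
            with ⇒ (equiv (⟨ N ∶ a ⟩ Ψ) (h-fwd h) scoped-below-N) (X' , e , sX , ℓe , sat)
        where
        scoped-below-N : Scoped N (⟨ N ∶ a ⟩ Ψ)
        scoped-below-N x (fi-fwd x≢N q) = ≤∧≢⇒< (≤-pred (scoped x q)) x≢N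
      ... | Y' , e' , sY , ℓe' , sat' with represented Y' (e' , sY , ℓe')
      ... | L , L∈Ls , Y'=L = refutes L L∈Ls Y' e' sY ℓe' Y'=L sat'

  matched-forth : ∀ {Act} {𝓒 𝓓 : ConfStructure Act} → Stable 𝓒 → Stable 𝓓 → ImageFinite 𝓓 →
                  ∀ {X Y f e X' a} → Matched 𝓒 𝓓 X Y f → Step 𝓒 X e X' → ConfStructure.ℓ 𝓒 e ≡ a →
                  ∃[ Y' ] ∃[ e' ] (Step 𝓓 Y e' Y' × ConfStructure.ℓ 𝓓 e' ≡ a ×
                                   Matched 𝓒 𝓓 X' Y' (extend f e e'))
  matched-forth {𝓒 = 𝓒} {𝓓} stC stD image-finite {X} {Y} {f} {e} {X'} {a} m sX ℓe
    with dec (∃[ Y' ] ∃[ e' ] (Step 𝓓 Y e' Y' × ConfStructure.ℓ 𝓓 e' ≡ a ×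
                EquivBelow 𝓒 𝓓 X' Y' (Unmatched.ρ' image-finite m sX ℓe) (Unmatched.σ' image-finite m sX ℓe e')
                  (suc (Matched.N m))))
  ... | yes (Y' , e' , sY , ℓe' , equiv') =
        Y' , e' , sY , ℓe' , matched-extend stC stD m sX sY (trans ℓe (sym ℓe')) equiv'
  ... | no none = ⊥-elim (Unmatched.absurd image-finite m sX ℓe none)

  -- The empty configurations are matched: closed formulas are exactly those scoped below 0.
  matched-initial : ∀ {Act} {𝓒 𝓓 : ConfStructure Act} → Stable 𝓒 → Stable 𝓓 → EquivH 𝓒 𝓓 →
                    Matched 𝓒 𝓓 [] [] (emptyRel 𝓒 𝓓)
  matched-initial {𝓒 = 𝓒} {𝓓} stC stD equivH = record
    { confX = Stable.empty-conf stC ; confY = Stable.empty-conf stD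
    ; iso = record { dom⊆ = λ _ _ () ; total = λ _ () ; surj = λ _ () ; func = λ _ _ _ ()
                   ; inj = λ _ _ _ () ; labels = λ _ _ () ; order = λ _ _ _ _ () }
    ; N = 0 ; ρ = emptyEnv 𝓒 ; σ = emptyEnv 𝓓
    ; naming = record { ρ→σ = λ _ _ () ; σ→ρ = λ _ _ () ; ρ-covers = λ _ () ; σ-covers = λ _ ()
                      ; ρ-below = λ _ _ → refl ; σ-below = λ _ _ → refl }
    ; equiv = λ φ h scoped → equivH φ h λ x q → n≮0 (scoped x q) }

  -- Matched triples form an H bisimulation; back is forth for the flipped structures.
  completeness : ∀ {Act} {𝓒 𝓓 : ConfStructure Act} → Stable 𝓒 → Stable 𝓓 → ImageFinite 𝓒 →
                 ImageFinite 𝓓 → EquivH 𝓒 𝓓 → HBisimilar 𝓒 𝓓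
  completeness {𝓒 = 𝓒} {𝓓} stC stD finC finD equivH = Matched 𝓒 𝓓 , record
    { init = matched-initial stC stD equivH
    ; confs = λ m → Matched.confX m , Matched.confY m
    ; iso = Matched.iso
    ; forth = λ {X} {Y} {f} m a X' (e , sX , ℓe) →
        let (Y' , e' , sY , ℓe' , m') = matched-forth stC stD finD m sX ℓe in
        Y' , extend f e e' , (e' , sY , ℓe') , m' ,
        restricts-after-step sX (Matched.iso m) (λ _ _ → map₂ proj₁) (λ _ _ → inj₁)
    ; back = λ {X} {Y} {f} m a Y' (e' , sY , ℓe') →
        let (X' , e , sX , ℓe , m') = matched-forth stD stC finC (matched-flip m) sY ℓe' in
        X' , flip (extend (flip f) e' e) , (e , sX , ℓe) , matched-flip m' ,
        restricts-after-step sX (Matched.iso m) (λ _ _ → map₂ proj₂) (λ _ _ → inj₁) }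

theorem2 : ExcludedMiddle (lsuc 0ℓ) →
    {Act : Set} (𝓒 𝓓 : ConfStructure Act) →
    Stable 𝓒 → Stable 𝓓 → ImageFinite 𝓒 → ImageFinite 𝓓 →
    (HBisimilar 𝓒 𝓓 ⇔ EquivH 𝓒 𝓓)
theorem2 em 𝓒 𝓓 stC stD finC finD =
  mk⇔ (soundness stC stD) (completeness stC stD finC finD)
  where open Classical em
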